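{- Let $\chi$ be a Dirichlet character, possibly trivial. Let $P\in q\,\mathbb{C}[q]$ be a polynomial in $q$ without constant term, and let $i\le0$ be an integer. Then the formal power series $\mathbf{L}_q(\chi,i)P$ is the expansion at $q=0$ of a rational function of $q$.
   Context: For $n\ge1$, let $[n]=\frac{q^n-1}{q-1}=1+q+\dots+q^{n-1}$ and $F_n(f)(q)=f(q^n)$. For a Dirichlet character $\chi$ (a periodic completely multiplicative function on the positive integers, with $\chi=1$ identically for the trivial character), define the operator $$\mathbf{L}_q(\chi,s)=\sum_{n\ge1}\chi(n)\,[n]^{ -s}F_n$$ on $q\,\mathbb{C}[[q]]$, where $[n]^{ -s}F_n$ denotes $f\mapsto[n]^{ -s}f(q^n)$. For an integer $i\le0$, $[n]^{ -i}$ is the polynomial $[n]^{|i|}$. -}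

module Defs where

open import Level using (Level; _⊔_)
open import Algebra.Bundles using (CommutativeRing)
open import Data.Nat as ℕ using (ℕ; zero; suc; _∸_; _≤_; _%_; _/_)
open import Data.List using (List; []; _∷_)
open import Data.Product using (Σ; _×_; ∃)
open import Relation.Nullary using (yes; no)
open import Relation.Binary.PropositionalEquality using (_≡_)

module _ {c ℓ : Level} (R : CommutativeRing c ℓ) where
  open CommutativeRing R

  Series : Set c
  Series = ℕ → Carrier

  sumBelow : ℕ → (ℕ → Carrier) → Carrier
  sumBelow zero    f = 0#
  sumBelow (suc n) f = sumBelow n f + f n

  mulS : Series → Series → Series
  mulS f g d = sumBelow (suc d) (λ i → f i * g (d ∸ i))

  oneS : Series
  oneS zero    = 1#
  oneS (suc _) = 0#

  powS : Series → ℕ → Series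
  powS f zero    = oneS
  powS f (suc k) = mulS f (powS f k)

  scaleS : Carrier → Series → Series
  scaleS a f d = a * f d

  -- polynomials: coefficient lists, head = constant coefficient
  Poly : Set c
  Poly = List Carrier

  coeff : Poly → ℕ → Carrier
  coeff []      _       = 0#
  coeff (a ∷ p) zero    = a
  coeff (a ∷ p) (suc d) = coeff p d

  -- q-integer [n] = 1 + q + ... + q^(n-1)
  qInt : ℕ → Series
  qInt n d with d ℕ.<? n
  ... | yes _ = 1#
  ... | no  _ = 0#

  -- F_n f (q) = f (q^n), for n ≥ 1 (written n = suc m)
  Fop : ℕ → Series → Series
  Fop m f d with d % suc m ℕ.≟ 0
  ... | yes _ = f (d / suc m)
  ... | no  _ = 0#

  -- L_q(χ, -k) f = Σ_{n ≥ 1} χ(n) [n]^k f(q^n), for f ∈ q R[[q]].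
  -- For such f, the n-th summand has q-adic valuation ≥ n, so the
  -- coefficient of q^d only receives contributions from 1 ≤ n ≤ d.
  Lq : (ℕ → Carrier) → ℕ → Series → Series
  Lq χ k f d =
    sumBelow d (λ m → scaleS (χ (suc m)) (mulS (powS (qInt (suc m)) k) (Fop m f)) d)

  -- Dirichlet character: periodic, completely multiplicative function on
  -- the positive integers (value at 0 irrelevant)
  record IsDirichletCharacter (χ : ℕ → Carrier) : Set (c ⊔ ℓ) where
    field
      period      : ℕ
      period-pos  : 1 ≤ period
      periodic    : ∀ n → 1 ≤ n → χ (n ℕ.+ period) ≈ χ n
      χ-one       : χ 1 ≈ 1#
      χ-mult      : ∀ m n → 1 ≤ m → 1 ≤ n → χ (m ℕ.* n) ≈ χ m * χ n

  -- F is the expansion at q = 0 of a rational function A/B, B(0) ≠ 0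
  -- (normalized to B(0) = 1), i.e. B·F = A as power series
  IsRationalExpansion : Series → Set (c ⊔ ℓ)
  IsRationalExpansion F =
    Σ Poly λ A → Σ Poly λ B →
      (coeff B 0 ≈ 1#) × (∀ d → mulS (coeff B) F d ≈ coeff A d)

-- Multiplying by (1 - q)^k turns [n]^k into (1 - q^n)^k, which commutes with q ↦ q^n; hence
-- (1 - q)^k L_q(χ, -k) P = L_q(χ, 0) Q for the polynomial Q = (1 - q)^k P, still without constant
-- term. Expanding Q = Σ_j Q_j q^j gives L_q(χ, 0) Q = Σ_j Q_j Σ_n χ(n) q^(jn), and the coefficients
-- of the inner series are periodic from degree 1 on, with period j N for N a period of χ. So for
-- M = J! N, with J bounding the degree of Q, (1 - q^M) (1 - q)^k L_q(χ, -k) P is a polynomial.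
module Submission where

open import Level using (Level)
open import Algebra.Bundles using (CommutativeRing)
open import Data.Nat using (ℕ)
open import Defs

module Rationality {c ℓ : Level} (R : CommutativeRing c ℓ) where

  open import Data.Nat as ℕ using (zero; suc; _∸_; _≤_; _<_; z≤n; s≤s; _≟_; _<?_; _≤?_; _%_; _/_; _!)
  import Data.Nat.Properties as ℕₚ
  open import Data.Nat.DivMod using (m≡m%n+[m/n]*n; [m+n]%n≡m%n; m*n%n≡0; m*n/n≡m; m<n⇒m%n≡m; m/n≡1+[m∸n]/n)
  open import Data.Nat.Divisibility using (_∣_; divides; _∣?_; ∣-trans; m∣m*n; n∣m*n*o; ∣m+n∣m⇒∣n; m≤n⇒m!∣n!)
  open import Data.Nat.Tactic.RingSolver using (solve-∀)
  open import Data.Empty using (⊥-elim)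
  open import Data.List using ([]; _∷_; length)
  open import Data.Product using (_,_)
  open import Data.Sum using (inj₁; inj₂)
  open import Function using (_∘_)
  open import Relation.Nullary using (yes; no; ¬_)
  open import Relation.Binary.PropositionalEquality as ≡ using (_≡_; _≢_)
  open import Relation.Binary.Bundles using (Setoid)
  open import Relation.Binary.Definitions using (tri<; tri≈; tri>)
  open import Function.Indexed.Relation.Binary.Equality using (≡-setoid)
  import Relation.Binary.Indexed.Heterogeneous.Construct.Trivial as Trivial
  import Relation.Binary.Reasoning.Setoid as SetoidReasoning

  open CommutativeRing R
  open SetoidReasoning setoid
  open import Algebra.Properties.CommutativeSemigroup +-commutativeSemigroup using () renaming (interchange to +-interchange)
  open import Algebra.Properties.CommutativeSemigroup *-commutativeSemigroup using () renaming (x∙yz≈y∙xz to x*yz≈y*xz)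
  open import Algebra.Properties.AbelianGroup +-abelianGroup using (⁻¹-∙-comm)
  open import Algebra.Properties.Group +-group using (x≈y⇒x∙y⁻¹≈ε)
  open import Algebra.Properties.Ring ring using (-0#≈0#; [y-z]x≈yx-zx; x[y-z]≈xy-xz)

  [x-y]+[z-w]≈[x+z]-[y+w] : ∀ x y z w → (x - y) + (z - w) ≈ (x + z) - (y + w)
  [x-y]+[z-w]≈[x+z]-[y+w] x y z w = trans (+-interchange x (- y) z (- w)) (+-congˡ (⁻¹-∙-comm y w))

  [x-y]-[z-w]≈[x-z]-[y-w] : ∀ x y z w → (x - y) - (z - w) ≈ (x - z) - (y - w)
  [x-y]-[z-w]≈[x-z]-[y-w] x y z w = begin
    (x - y) - (z - w)      ≈⟨ +-congˡ (sym (⁻¹-∙-comm z (- w))) ⟩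
    (x - y) + (- z - - w)  ≈⟨ +-interchange x (- y) (- z) (- - w) ⟩
    (x - z) + (- y - - w)  ≈⟨ +-congˡ (⁻¹-∙-comm y (- w)) ⟩
    (x - z) - (y - w)      ∎

  ∑ : ℕ → (ℕ → Carrier) → Carrier
  ∑ = sumBelow R

  ∑-cong-< : ∀ n {f g : ℕ → Carrier} → (∀ i → i < n → f i ≈ g i) → ∑ n f ≈ ∑ n g
  ∑-cong-< zero    f≈g = refl
  ∑-cong-< (suc n) f≈g = +-cong (∑-cong-< n (λ i i<n → f≈g i (ℕₚ.m<n⇒m<1+n i<n))) (f≈g n (ℕₚ.n<1+n n))

  ∑-cong : ∀ n {f g : ℕ → Carrier} → (∀ i → f i ≈ g i) → ∑ n f ≈ ∑ n g
  ∑-cong n f≈g = ∑-cong-< n (λ i _ → f≈g i)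

  ∑-zero : ∀ n {f : ℕ → Carrier} → (∀ i → i < n → f i ≈ 0#) → ∑ n f ≈ 0#
  ∑-zero zero    f≈0 = refl
  ∑-zero (suc n) f≈0 = trans (+-cong (∑-zero n (λ i i<n → f≈0 i (ℕₚ.m<n⇒m<1+n i<n))) (f≈0 n (ℕₚ.n<1+n n))) (+-identityˡ 0#)

  ∑-distrib-+ : ∀ n (f g : ℕ → Carrier) → ∑ n (λ i → f i + g i) ≈ ∑ n f + ∑ n g
  ∑-distrib-+ zero    f g = sym (+-identityˡ 0#)
  ∑-distrib-+ (suc n) f g = trans (+-congʳ (∑-distrib-+ n f g)) (+-interchange _ _ _ _)

  ∑-distrib-difference : ∀ n (f g : ℕ → Carrier) → ∑ n (λ i → f i - g i) ≈ ∑ n f - ∑ n g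
  ∑-distrib-difference zero    f g = sym (-‿inverseʳ 0#)
  ∑-distrib-difference (suc n) f g = trans (+-congʳ (∑-distrib-difference n f g)) ([x-y]+[z-w]≈[x+z]-[y+w] _ _ _ _)

  *-distribˡ-∑ : ∀ n a (f : ℕ → Carrier) → a * ∑ n f ≈ ∑ n (λ i → a * f i)
  *-distribˡ-∑ zero    a f = zeroʳ a
  *-distribˡ-∑ (suc n) a f = trans (distribˡ a _ _) (+-congʳ (*-distribˡ-∑ n a f))

  ∑-suc : ∀ n (f : ℕ → Carrier) → ∑ (suc n) f ≈ f 0 + ∑ n (f ∘ suc)
  ∑-suc zero    f = +-comm 0# (f 0)
  ∑-suc (suc n) f = trans (+-congʳ (∑-suc n f)) (+-assoc _ _ _)

  ∑-extend : ∀ m n {f : ℕ → Carrier} → n ≤ m → (∀ i → n ≤ i → i < m → f i ≈ 0#) → ∑ m f ≈ ∑ n f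
  ∑-extend zero    zero    _   _   = refl
  ∑-extend (suc m) n       n≤m f≈0 with n ≤? m
  ... | yes n≤m = trans (+-cong (∑-extend m n n≤m (λ i n≤i i<m → f≈0 i n≤i (ℕₚ.m<n⇒m<1+n i<m))) (f≈0 m n≤m (ℕₚ.n<1+n m))) (+-identityʳ _)
  ... | no  n≰m with ≡.refl ← ℕₚ.≤-antisym n≤m (ℕₚ.≰⇒> n≰m) = refl

  ∑-single : ∀ n a {f : ℕ → Carrier} → a < n → (∀ i → i < n → i ≢ a → f i ≈ 0#) → ∑ n f ≈ f a
  ∑-single (suc n) a a<1+n f≈0 with a ≟ n
  ... | yes ≡.refl = trans (+-congʳ (∑-zero n (λ i i<n → f≈0 i (ℕₚ.m<n⇒m<1+n i<n) (ℕₚ.<⇒≢ i<n)))) (+-identityˡ _)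
  ... | no  a≢n    = trans (+-cong (∑-single n a a<n (λ i i<n → f≈0 i (ℕₚ.m<n⇒m<1+n i<n))) (f≈0 n (ℕₚ.n<1+n n) (a≢n ∘ ≡.sym))) (+-identityʳ _)
    where
    a<n : a < n
    a<n = ℕₚ.≤∧≢⇒< (ℕₚ.≤-pred a<1+n) a≢n

  ∑-comm : ∀ m n (f : ℕ → ℕ → Carrier) → ∑ m (λ i → ∑ n (f i)) ≈ ∑ n (λ j → ∑ m (λ i → f i j))
  ∑-comm zero    n f = sym (∑-zero n (λ _ _ → refl))
  ∑-comm (suc m) n f = trans (+-congʳ (∑-comm m n f)) (sym (∑-distrib-+ n _ _))

  -- Power series and the operators 1 - q^n

  Ser : Set c
  Ser = Series R

  seriesSetoid : Setoid c ℓ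
  seriesSetoid = ≡-setoid ℕ (Trivial.indexedSetoid setoid)

  open Setoid seriesSetoid using () renaming (_≈_ to _≋_; refl to ≋-refl; sym to ≋-sym; trans to ≋-trans)

  _⊖_ : Ser → Ser → Ser
  (f ⊖ g) d = f d - g d

  scale : Carrier → Ser → Ser
  scale = scaleS R

  ∑ₛ : ℕ → (ℕ → Ser) → Ser
  ∑ₛ L T d = ∑ L (λ m → T m d)

  VanishesFrom : ℕ → Ser → Set ℓ
  VanishesFrom K f = ∀ e → K ≤ e → f e ≈ 0#

  VanishesFrom-resp : ∀ {K f g} → f ≋ g → VanishesFrom K f → VanishesFrom K g
  VanishesFrom-resp f≋g f≈0 e K≤e = trans (sym (f≋g e)) (f≈0 e K≤e)

  AgreeUpTo : ℕ → Ser → Ser → Set ℓ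
  AgreeUpTo L f g = ∀ d → d ≤ L → f d ≈ g d

  shift1 : Ser → Ser
  shift1 f zero    = 0#
  shift1 f (suc d) = f d

  shift : ℕ → Ser → Ser
  shift zero    f = f
  shift (suc n) f = shift1 (shift n f)

  shift1-cong : ∀ {f g} → f ≋ g → shift1 f ≋ shift1 g
  shift1-cong f≋g zero    = refl
  shift1-cong f≋g (suc d) = f≋g d

  shift-cong : ∀ n {f g} → f ≋ g → shift n f ≋ shift n g
  shift-cong zero    f≋g = f≋g
  shift-cong (suc n) f≋g = shift1-cong (shift-cong n f≋g)

  shift-below : ∀ n f d → d < n → shift n f d ≡ 0#
  shift-below (suc n) f zero    _         = ≡.refl
  shift-below (suc n) f (suc d) (s≤s d<n) = shift-below n f d d<n

  shift-above : ∀ n f d → n ≤ d → shift n f d ≡ f (d ∸ n)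
  shift-above zero    f d       _         = ≡.refl
  shift-above (suc n) f (suc d) (s≤s n≤d) = shift-above n f d n≤d

  shift-natural : (φ : Ser → Ser) → (∀ {f g} → f ≋ g → φ f ≋ φ g) →
                  (∀ f → shift1 (φ f) ≋ φ (shift1 f)) → ∀ n f → shift n (φ f) ≋ φ (shift n f)
  shift-natural φ φ-cong φ-shift1 zero    f = ≋-refl
  shift-natural φ φ-cong φ-shift1 (suc n) f =
    ≋-trans (shift1-cong (shift-natural φ φ-cong φ-shift1 n f)) (φ-shift1 (shift n f))

  shift-shift1 : ∀ n f → shift n (shift1 f) ≋ shift1 (shift n f)
  shift-shift1 = shift-natural shift1 shift1-cong (λ _ → ≋-refl)

  shift-comm : ∀ m n f → shift m (shift n f) ≋ shift n (shift m f)
  shift-comm m n f = ≋-sym (shift-natural (shift m) (shift-cong m) (λ g → ≋-sym (shift-shift1 m g)) n f)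

  shift-⊖ : ∀ n f g → shift n (f ⊖ g) ≋ shift n f ⊖ shift n g
  shift-⊖ zero    f g = ≋-refl
  shift-⊖ (suc n) f g zero    = sym (-‿inverseʳ 0#)
  shift-⊖ (suc n) f g (suc d) = shift-⊖ n f g d

  shift-scale : ∀ n a f → shift n (scale a f) ≋ scale a (shift n f)
  shift-scale n a = shift-natural (scale a) (λ f≋g d → *-congˡ (f≋g d)) shift1-scale n
    where
    shift1-scale : ∀ f → shift1 (scale a f) ≋ scale a (shift1 f)
    shift1-scale f zero    = sym (zeroʳ a)
    shift1-scale f (suc d) = refl

  shift-∑ₛ : ∀ n L T → shift n (∑ₛ L T) ≋ ∑ₛ L (shift n ∘ T)
  shift-∑ₛ zero    L T = ≋-refl
  shift-∑ₛ (suc n) L T zero    = sym (∑-zero L (λ _ _ → refl))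
  shift-∑ₛ (suc n) L T (suc d) = shift-∑ₛ n L T d

  shift-agree : ∀ L n {f g} → AgreeUpTo L f g → AgreeUpTo L (shift n f) (shift n g)
  shift-agree L zero    f≈g = f≈g
  shift-agree L (suc n) f≈g zero    _   = refl
  shift-agree L (suc n) f≈g (suc d) 1+d≤L = shift-agree L n f≈g d (ℕₚ.<⇒≤ 1+d≤L)

  Δ : ℕ → Ser → Ser
  Δ n f = f ⊖ shift n f

  Δ^ : ℕ → ℕ → Ser → Ser
  Δ^ n zero    f = f
  Δ^ n (suc k) f = Δ^ n k (Δ n f)

  Δ-cong : ∀ n {f g} → f ≋ g → Δ n f ≋ Δ n g
  Δ-cong n f≋g d = +-cong (f≋g d) (-‿cong (shift-cong n f≋g d))

  Δ^-cong : ∀ n k {f g} → f ≋ g → Δ^ n k f ≋ Δ^ n k g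
  Δ^-cong n zero    f≋g = f≋g
  Δ^-cong n (suc k) f≋g = Δ^-cong n k (Δ-cong n f≋g)

  Δ^-natural : ∀ m n (φ : Ser → Ser) → (∀ {f g} → f ≋ g → φ f ≋ φ g) →
               (∀ f → Δ m (φ f) ≋ φ (Δ n f)) → ∀ k f → Δ^ m k (φ f) ≋ φ (Δ^ n k f)
  Δ^-natural m n φ φ-cong φ-Δ zero    f = ≋-refl
  Δ^-natural m n φ φ-cong φ-Δ (suc k) f =
    ≋-trans (Δ^-cong m k (φ-Δ f)) (Δ^-natural m n φ φ-cong φ-Δ k (Δ n f))

  Δ-comm : ∀ a b f → Δ a (Δ b f) ≋ Δ b (Δ a f)
  Δ-comm a b f d = begin
    (f d - shift b f d) - shift a (f ⊖ shift b f) d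
      ≈⟨ +-congˡ (-‿cong (shift-⊖ a f (shift b f) d)) ⟩
    (f d - shift b f d) - (shift a f d - shift a (shift b f) d)
      ≈⟨ [x-y]-[z-w]≈[x-z]-[y-w] _ _ _ _ ⟩
    (f d - shift a f d) - (shift b f d - shift a (shift b f) d)
      ≈⟨ +-congˡ (-‿cong (+-congˡ (-‿cong (shift-comm a b f d)))) ⟩
    (f d - shift a f d) - (shift b f d - shift b (shift a f) d)
      ≈⟨ +-congˡ (-‿cong (sym (shift-⊖ b f (shift a f) d))) ⟩
    (f d - shift a f d) - shift b (f ⊖ shift a f) d
      ∎

  Δ^-Δ-comm : ∀ a b k f → Δ^ b k (Δ a f) ≋ Δ a (Δ^ b k f)
  Δ^-Δ-comm a b = Δ^-natural b b (Δ a) (Δ-cong a) (Δ-comm b a)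

  Δ^-scale : ∀ n k a f → Δ^ n k (scale a f) ≋ scale a (Δ^ n k f)
  Δ^-scale n k a = Δ^-natural n n (scale a) (λ f≋g d → *-congˡ (f≋g d)) Δ-scale k
    where
    Δ-scale : ∀ f → Δ n (scale a f) ≋ scale a (Δ n f)
    Δ-scale f d = trans (+-congˡ (-‿cong (shift-scale n a f d))) (sym (x[y-z]≈xy-xz a _ _))

  Δ^-∑ₛ : ∀ n k L T → Δ^ n k (∑ₛ L T) ≋ ∑ₛ L (Δ^ n k ∘ T)
  Δ^-∑ₛ n zero    L T = ≋-refl
  Δ^-∑ₛ n (suc k) L T = ≋-trans (Δ^-cong n k Δ-∑ₛ) (Δ^-∑ₛ n k L (Δ n ∘ T))
    where
    Δ-∑ₛ : Δ n (∑ₛ L T) ≋ ∑ₛ L (Δ n ∘ T)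
    Δ-∑ₛ d = trans (+-congˡ (-‿cong (shift-∑ₛ n L T d))) (sym (∑-distrib-difference L _ _))

  Δ^-agree : ∀ L n k {f g} → AgreeUpTo L f g → AgreeUpTo L (Δ^ n k f) (Δ^ n k g)
  Δ^-agree L n zero    f≈g = f≈g
  Δ^-agree L n (suc k) f≈g = Δ^-agree L n k (λ d d≤L → +-cong (f≈g d d≤L) (-‿cong (shift-agree L n f≈g d d≤L)))

  Δ-at-zero : ∀ n f → 1 ≤ n → Δ n f 0 ≈ f 0
  Δ-at-zero n f 1≤n = trans (+-congˡ (trans (-‿cong (reflexive (shift-below n f 0 1≤n))) -0#≈0#)) (+-identityʳ (f 0))

  Δ^-at-zero : ∀ n k f → 1 ≤ n → Δ^ n k f 0 ≈ f 0
  Δ^-at-zero n zero    f _   = refl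
  Δ^-at-zero n (suc k) f 1≤n = trans (Δ^-at-zero n k (Δ n f) 1≤n) (Δ-at-zero n f 1≤n)

  Δ-vanishes : ∀ n K {f} → VanishesFrom K f → VanishesFrom (n ℕ.+ K) (Δ n f)
  Δ-vanishes n K {f} f≈0 e n+K≤e = x≈y⇒x∙y⁻¹≈ε (begin
    f e                ≈⟨ f≈0 e (ℕₚ.m+n≤o⇒n≤o n n+K≤e) ⟩
    0#                 ≈⟨ f≈0 (e ∸ n) (ℕₚ.m+n≤o⇒m≤o∸n K (≡.subst (_≤ e) (ℕₚ.+-comm n K) n+K≤e)) ⟨
    f (e ∸ n)          ≡⟨ shift-above n f e (ℕₚ.m+n≤o⇒m≤o n n+K≤e) ⟨
    shift n f e        ∎)

  Δ^-vanishes : ∀ n k K {f} → VanishesFrom K f → VanishesFrom (k ℕ.* n ℕ.+ K) (Δ^ n k f)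
  Δ^-vanishes n zero    K f≈0 = f≈0
  Δ^-vanishes n (suc k) K f≈0 e k*n+n+K≤e =
    Δ^-vanishes n k (n ℕ.+ K) (Δ-vanishes n K f≈0) e
      (≡.subst (_≤ e) (≡.trans (≡.cong (ℕ._+ K) (ℕₚ.+-comm n (k ℕ.* n))) (ℕₚ.+-assoc (k ℕ.* n) n K)) k*n+n+K≤e)

  Δ-periodic-vanishes : ∀ M H → (∀ e → 1 ≤ e → H (M ℕ.+ e) ≈ H e) → VanishesFrom (suc M) (Δ M H)
  Δ-periodic-vanishes M H H-periodic d M<d = x≈y⇒x∙y⁻¹≈ε (begin
    H d                ≡⟨ ≡.cong H (ℕₚ.m+[n∸m]≡n M≤d) ⟨
    H (M ℕ.+ (d ∸ M))  ≈⟨ H-periodic (d ∸ M) (ℕₚ.m+n≤o⇒m≤o∸n 1 M<d) ⟩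
    H (d ∸ M)          ≡⟨ shift-above M H d M≤d ⟨
    shift M H d        ∎)
    where
    M≤d : M ≤ d
    M≤d = ℕₚ.<⇒≤ M<d

  _⋆_ : Ser → Ser → Ser
  _⋆_ = mulS R

  one : Ser
  one = oneS R

  ⋆-congˡ : ∀ {f g} h → f ≋ g → f ⋆ h ≋ g ⋆ h
  ⋆-congˡ h f≋g d = ∑-cong (suc d) (λ i → *-congʳ (f≋g i))

  ⋆-identityˡ : ∀ g → one ⋆ g ≋ g
  ⋆-identityˡ g d = trans (∑-suc d _) (trans (+-cong (*-identityˡ _) (∑-zero d (λ i _ → zeroˡ _))) (+-identityʳ _))

  ⋆-vanishes-upTo : ∀ f g m → (∀ e → e ≤ m → g e ≈ 0#) → ∀ d → d ≤ m → (f ⋆ g) d ≈ 0#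
  ⋆-vanishes-upTo f g m g≈0 d d≤m =
    ∑-zero (suc d) (λ i _ → trans (*-congˡ (g≈0 (d ∸ i) (ℕₚ.≤-trans (ℕₚ.m∸n≤m d i) d≤m))) (zeroʳ _))

  shift-⋆ : ∀ n f g → shift n (f ⋆ g) ≋ shift n f ⋆ g
  shift-⋆ n f g = shift-natural (_⋆ g) (⋆-congˡ g) shift1-⋆ n f
    where
    shift1-⋆ : ∀ f → shift1 (f ⋆ g) ≋ shift1 f ⋆ g
    shift1-⋆ f zero    = sym (trans (+-identityˡ _) (zeroˡ _))
    shift1-⋆ f (suc d) = sym (trans (∑-suc (suc d) _) (trans (+-congʳ (zeroˡ _)) (+-identityˡ _)))

  Δ-⋆ : ∀ n f g → Δ n (f ⋆ g) ≋ Δ n f ⋆ g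
  Δ-⋆ n f g d = begin
    (f ⋆ g) d - shift n (f ⋆ g) d                     ≈⟨ +-congˡ (-‿cong (shift-⋆ n f g d)) ⟩
    (f ⋆ g) d - (shift n f ⋆ g) d                     ≈⟨ ∑-distrib-difference (suc d) _ _ ⟨
    ∑ (suc d) (λ i → f i * g (d ∸ i) - shift n f i * g (d ∸ i))
                                                      ≈⟨ ∑-cong (suc d) (λ i → [y-z]x≈yx-zx (g (d ∸ i)) _ _) ⟨
    (Δ n f ⋆ g) d                                     ∎

  Δ^-⋆ : ∀ n k f g → Δ^ n k (f ⋆ g) ≋ Δ^ n k f ⋆ g
  Δ^-⋆ n k f g = Δ^-natural n n (_⋆ g) (⋆-congˡ g) (λ f → Δ-⋆ n f g) k f

  [_] : ℕ → Ser
  [_] = qInt R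

  [n]-below : ∀ n d → d < n → [ n ] d ≡ 1#
  [n]-below n d d<n with d <? n
  ... | yes _   = ≡.refl
  ... | no  d≮n = ⊥-elim (d≮n d<n)

  [n]-above : ∀ n d → n ≤ d → [ n ] d ≡ 0#
  [n]-above n d n≤d with d <? n
  ... | yes d<n = ⊥-elim (ℕₚ.<⇒≱ d<n n≤d)
  ... | no  _   = ≡.refl

  Δ-[n] : ∀ n → 1 ≤ n → Δ 1 [ n ] ≋ Δ n one
  Δ-[n] n 1≤n zero = +-cong (reflexive ([n]-below n 0 1≤n)) (-‿cong (sym (reflexive (shift-below n one 0 1≤n))))
  Δ-[n] n 1≤n (suc e) with ℕₚ.<-cmp (suc e) n
  ... | tri< 1+e<n _ _ = trans
    (x≈y⇒x∙y⁻¹≈ε (trans (reflexive ([n]-below n (suc e) 1+e<n)) (sym (reflexive ([n]-below n e (ℕₚ.<-trans (ℕₚ.n<1+n e) 1+e<n))))))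
    (sym (x≈y⇒x∙y⁻¹≈ε (sym (reflexive (shift-below n one (suc e) 1+e<n)))))
  ... | tri≈ _ ≡.refl _ = +-cong (reflexive ([n]-above n n ℕₚ.≤-refl))
    (-‿cong (trans (reflexive ([n]-below n e (ℕₚ.n<1+n e)))
                   (sym (reflexive (≡.trans (shift-above n one n ℕₚ.≤-refl) (≡.cong one (ℕₚ.n∸n≡0 n)))))))
  ... | tri> _ _ n<1+e = +-cong (reflexive ([n]-above n (suc e) (ℕₚ.<⇒≤ n<1+e)))
    (-‿cong (trans (reflexive ([n]-above n e (ℕₚ.≤-pred n<1+e)))
                   (sym (reflexive (≡.trans (shift-above n one (suc e) (ℕₚ.<⇒≤ n<1+e))
                                            (≡.cong one (ℕₚ.+-∸-assoc 1 (ℕₚ.≤-pred n<1+e))))))))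

  Δ^-[n]^ : ∀ n k X → 1 ≤ n → Δ^ 1 k (powS R [ n ] k ⋆ X) ≋ Δ^ n k X
  Δ^-[n]^ n zero    X _   = ⋆-identityˡ X
  Δ^-[n]^ n (suc k) X 1≤n d = begin
    Δ^ 1 k (Δ 1 (([ n ] ⋆ Pk) ⋆ X)) d  ≈⟨ Δ^-cong 1 k Δ-step d ⟩
    Δ^ 1 k (Δ n (Pk ⋆ X)) d            ≈⟨ Δ^-Δ-comm n 1 k (Pk ⋆ X) d ⟩
    Δ n (Δ^ 1 k (Pk ⋆ X)) d            ≈⟨ Δ-cong n (Δ^-[n]^ n k X 1≤n) d ⟩
    Δ n (Δ^ n k X) d                   ≈⟨ Δ^-Δ-comm n n k X d ⟨
    Δ^ n k (Δ n X) d                   ∎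
    where
    Pk : Ser
    Pk = powS R [ n ] k
    Δ-step : Δ 1 (([ n ] ⋆ Pk) ⋆ X) ≋ Δ n (Pk ⋆ X)
    Δ-step e = begin
      Δ 1 (([ n ] ⋆ Pk) ⋆ X) e   ≈⟨ Δ-⋆ 1 _ X e ⟩
      (Δ 1 ([ n ] ⋆ Pk) ⋆ X) e   ≈⟨ ⋆-congˡ X (Δ-⋆ 1 [ n ] Pk) e ⟩
      ((Δ 1 [ n ] ⋆ Pk) ⋆ X) e   ≈⟨ ⋆-congˡ X (⋆-congˡ Pk (Δ-[n] n 1≤n)) e ⟩
      ((Δ n one ⋆ Pk) ⋆ X) e     ≈⟨ ⋆-congˡ X (Δ-⋆ n one Pk) e ⟨
      (Δ n (one ⋆ Pk) ⋆ X) e     ≈⟨ ⋆-congˡ X (Δ-cong n (⋆-identityˡ Pk)) e ⟩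
      (Δ n Pk ⋆ X) e             ≈⟨ Δ-⋆ n Pk X e ⟨
      Δ n (Pk ⋆ X) e             ∎

  -- The substitution q ↦ q^(m+1)

  F : ℕ → Ser → Ser
  F = Fop R

  F-divisible : ∀ m f d → d % suc m ≡ 0 → F m f d ≡ f (d / suc m)
  F-divisible m f d d%n≡0 with d % suc m ≟ 0
  ... | yes _    = ≡.refl
  ... | no d%n≢0 = ⊥-elim (d%n≢0 d%n≡0)

  F-indivisible : ∀ m f d → d % suc m ≢ 0 → F m f d ≡ 0#
  F-indivisible m f d d%n≢0 with d % suc m ≟ 0
  ... | yes d%n≡0 = ⊥-elim (d%n≢0 d%n≡0)
  ... | no _      = ≡.refl

  F-cong : ∀ m {f g} → f ≋ g → F m f ≋ F m g
  F-cong m f≋g d with d % suc m ≟ 0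
  ... | yes _ = f≋g _
  ... | no  _ = refl

  F-⊖ : ∀ m f g → F m (f ⊖ g) ≋ F m f ⊖ F m g
  F-⊖ m f g d with d % suc m ≟ 0
  ... | yes _ = refl
  ... | no  _ = sym (-‿inverseʳ 0#)

  F-scale : ∀ m a f → F m (scale a f) ≋ scale a (F m f)
  F-scale m a f d with d % suc m ≟ 0
  ... | yes _ = refl
  ... | no  _ = sym (zeroʳ a)

  F-∑ₛ : ∀ m L T → F m (∑ₛ L T) ≋ ∑ₛ L (F m ∘ T)
  F-∑ₛ m L T d with d % suc m ≟ 0
  ... | yes _ = refl
  ... | no  _ = sym (∑-zero L (λ _ _ → refl))

  F-vanishes-upTo : ∀ m f → f 0 ≈ 0# → ∀ d → d ≤ m → F m f d ≈ 0#
  F-vanishes-upTo m f f0≈0 d d≤m with d % suc m ≟ 0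
  ... | no  _     = refl
  ... | yes d%n≡0 with ≡.refl ← ≡.trans (≡.sym (m<n⇒m%n≡m (s≤s d≤m))) d%n≡0 = f0≈0

  F-shift1-step : ∀ m f e → F m (shift1 f) (e ℕ.+ suc m) ≈ F m f e
  F-shift1-step m f e with e % suc m ≟ 0
  ... | yes e%n≡0 = begin
    F m (shift1 f) (e ℕ.+ suc m)      ≡⟨ F-divisible m (shift1 f) (e ℕ.+ suc m) (≡.trans ([m+n]%n≡m%n e (suc m)) e%n≡0) ⟩
    shift1 f ((e ℕ.+ suc m) / suc m)  ≡⟨ ≡.cong (shift1 f) [e+n]/n≡1+e/n ⟩
    f (e / suc m)                     ∎
    where
    [e+n]/n≡1+e/n : (e ℕ.+ suc m) / suc m ≡ suc (e / suc m)
    [e+n]/n≡1+e/n = ≡.trans (m/n≡1+[m∸n]/n (ℕₚ.m≤n+m (suc m) e)) (≡.cong (λ x → suc (x / suc m)) (ℕₚ.m+n∸n≡m e (suc m)))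
  ... | no e%n≢0 = reflexive (F-indivisible m (shift1 f) (e ℕ.+ suc m) (e%n≢0 ∘ ≡.trans (≡.sym ([m+n]%n≡m%n e (suc m)))))

  shift-F : ∀ m f → shift (suc m) (F m f) ≋ F m (shift1 f)
  shift-F m f d with ℕₚ.<-≤-connex d (suc m)
  ... | inj₁ d<n = trans (reflexive (shift-below (suc m) (F m f) d d<n)) (sym (F-vanishes-upTo m (shift1 f) refl d (ℕₚ.≤-pred d<n)))
  ... | inj₂ n≤d = begin
    shift (suc m) (F m f) d                ≡⟨ shift-above (suc m) (F m f) d n≤d ⟩
    F m f (d ∸ suc m)                      ≈⟨ F-shift1-step m f (d ∸ suc m) ⟨
    F m (shift1 f) (d ∸ suc m ℕ.+ suc m)   ≡⟨ ≡.cong (F m (shift1 f)) (ℕₚ.m∸n+n≡m n≤d) ⟩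
    F m (shift1 f) d                       ∎

  Δ^-F : ∀ m k f → Δ^ (suc m) k (F m f) ≋ F m (Δ^ 1 k f)
  Δ^-F m = Δ^-natural (suc m) 1 (F m) (F-cong m) Δ-F
    where
    Δ-F : ∀ f → Δ (suc m) (F m f) ≋ F m (Δ 1 f)
    Δ-F f d = trans (+-congˡ (-‿cong (shift-F m f d))) (sym (F-⊖ m f (shift1 f) d))

  monomial : ℕ → Ser
  monomial j e with j ≟ e
  ... | yes _ = 1#
  ... | no  _ = 0#

  monomial-diag : ∀ j → monomial j j ≈ 1#
  monomial-diag j with j ≟ j
  ... | yes _   = refl
  ... | no  j≢j = ⊥-elim (j≢j ≡.refl)

  monomial-offdiag : ∀ j e → j ≢ e → monomial j e ≈ 0#
  monomial-offdiag j e j≢e with j ≟ e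
  ... | yes j≡e = ⊥-elim (j≢e j≡e)
  ... | no  _   = refl

  monomial-expansion : ∀ J Q → VanishesFrom J Q → Q ≋ ∑ₛ J (λ j → scale (Q j) (monomial j))
  monomial-expansion J Q Q≈0 e with e <? J
  ... | yes e<J = sym (trans (∑-single J e e<J (λ j _ j≢e → trans (*-congˡ (monomial-offdiag j e j≢e)) (zeroʳ _)))
                             (trans (*-congˡ (monomial-diag e)) (*-identityʳ _)))
  ... | no  e≮J = trans (Q≈0 e J≤e) (sym (∑-zero J (λ j j<J → trans (*-congˡ (monomial-offdiag j e (ℕₚ.<⇒≢ (ℕₚ.<-≤-trans j<J J≤e)))) (zeroʳ _))))
    where
    J≤e : J ≤ e
    J≤e = ℕₚ.≮⇒≥ e≮J

  F-monomial-off : ∀ m j d → d ≢ j ℕ.* suc m → F m (monomial j) d ≈ 0#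
  F-monomial-off m j d d≢jn with d % suc m ≟ 0
  ... | no  _     = refl
  ... | yes d%n≡0 = monomial-offdiag j (d / suc m) (λ j≡d/n → d≢jn
    (≡.trans (m≡m%n+[m/n]*n d (suc m)) (≡.cong₂ (λ r q → r ℕ.+ q ℕ.* suc m) d%n≡0 (≡.sym j≡d/n))))

  F-monomial-on : ∀ m j → F m (monomial j) (j ℕ.* suc m) ≈ 1#
  F-monomial-on m j = begin
    F m (monomial j) (j ℕ.* suc m)      ≡⟨ F-divisible m (monomial j) (j ℕ.* suc m) (m*n%n≡0 j (suc m)) ⟩
    monomial j (j ℕ.* suc m / suc m)    ≡⟨ ≡.cong (monomial j) (m*n/n≡m j (suc m)) ⟩
    monomial j j                        ≈⟨ monomial-diag j ⟩
    1#                                  ∎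

  -- L_q(χ, -k) and L_q(χ, 0)

  module _ (χ : ℕ → Carrier) where

    Lq-term : ℕ → Ser → ℕ → Ser
    Lq-term k f m = scale (χ (suc m)) (powS R [ suc m ] k ⋆ F m f)

    Lq-agrees-∑ₛ : ∀ k f → f 0 ≈ 0# → ∀ L → AgreeUpTo L (Lq R χ k f) (∑ₛ L (Lq-term k f))
    Lq-agrees-∑ₛ k f f0≈0 L d d≤L = sym (∑-extend L d d≤L (λ m d≤m _ → Lq-term-vanishes m d d≤m))
      where
      Lq-term-vanishes : ∀ m d → d ≤ m → Lq-term k f m d ≈ 0#
      Lq-term-vanishes m d d≤m =
        trans (*-congˡ (⋆-vanishes-upTo (powS R [ suc m ] k) (F m f) m (F-vanishes-upTo m f f0≈0) d d≤m)) (zeroʳ _)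

    L₀ : Ser → Ser
    L₀ g d = ∑ d (λ m → χ (suc m) * F m g d)

    Δ^-Lq : ∀ k f → f 0 ≈ 0# → Δ^ 1 k (Lq R χ k f) ≋ L₀ (Δ^ 1 k f)
    Δ^-Lq k f f0≈0 d = begin
      Δ^ 1 k (Lq R χ k f) d                 ≈⟨ Δ^-agree d 1 k (Lq-agrees-∑ₛ k f f0≈0 d) d ℕₚ.≤-refl ⟩
      Δ^ 1 k (∑ₛ d (Lq-term k f)) d         ≈⟨ Δ^-∑ₛ 1 k d (Lq-term k f) d ⟩
      ∑ d (λ m → Δ^ 1 k (Lq-term k f m) d)  ≈⟨ ∑-cong d (λ m → Δ^-Lq-term m d) ⟩
      L₀ (Δ^ 1 k f) d                       ∎
      where
      Δ^-Lq-term : ∀ m → Δ^ 1 k (Lq-term k f m) ≋ scale (χ (suc m)) (F m (Δ^ 1 k f))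
      Δ^-Lq-term m e = trans (Δ^-scale 1 k _ _ e)
        (*-congˡ (trans (Δ^-[n]^ (suc m) k (F m f) (s≤s z≤n) e) (Δ^-F m k f e)))

    L₀-cong : ∀ {f g} → f ≋ g → L₀ f ≋ L₀ g
    L₀-cong f≋g d = ∑-cong d (λ m → *-congˡ (F-cong m f≋g d))

    L₀-scale : ∀ a f → L₀ (scale a f) ≋ scale a (L₀ f)
    L₀-scale a f d = begin
      ∑ d (λ m → χ (suc m) * F m (scale a f) d)  ≈⟨ ∑-cong d (λ m → trans (*-congˡ (F-scale m a f d)) (x*yz≈y*xz _ a _)) ⟩
      ∑ d (λ m → a * (χ (suc m) * F m f d))      ≈⟨ *-distribˡ-∑ d a _ ⟨
      a * L₀ f d                                 ∎

    L₀-∑ₛ : ∀ L T → L₀ (∑ₛ L T) ≋ ∑ₛ L (L₀ ∘ T)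
    L₀-∑ₛ L T d = begin
      ∑ d (λ m → χ (suc m) * F m (∑ₛ L T) d)          ≈⟨ ∑-cong d (λ m → trans (*-congˡ (F-∑ₛ m L T d)) (*-distribˡ-∑ L _ _)) ⟩
      ∑ d (λ m → ∑ L (λ j → χ (suc m) * F m (T j) d)) ≈⟨ ∑-comm d L _ ⟩
      ∑ₛ L (L₀ ∘ T) d                                 ∎

    L₀-monomial-multiple : ∀ j c → L₀ (monomial (suc j)) (suc j ℕ.* suc c) ≈ χ (suc c)
    L₀-monomial-multiple j c = begin
      L₀ (monomial (suc j)) (suc j ℕ.* suc c)              ≈⟨ ∑-single _ c (ℕₚ.m≤n*m (suc c) (suc j)) off-c ⟩
      χ (suc c) * F c (monomial (suc j)) (suc j ℕ.* suc c) ≈⟨ *-congˡ (F-monomial-on c (suc j)) ⟩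
      χ (suc c) * 1#                                       ≈⟨ *-identityʳ _ ⟩
      χ (suc c)                                            ∎
      where
      off-c : ∀ i → i < suc j ℕ.* suc c → i ≢ c → χ (suc i) * F i (monomial (suc j)) (suc j ℕ.* suc c) ≈ 0#
      off-c i _ i≢c = trans (*-congˡ (F-monomial-off i (suc j) _
        (λ eq → i≢c (≡.sym (ℕₚ.suc-injective (ℕₚ.*-cancelˡ-≡ (suc c) (suc i) (suc j) eq)))))) (zeroʳ _)

    L₀-monomial-nonmultiple : ∀ j d → ¬ (j ∣ d) → L₀ (monomial j) d ≈ 0#
    L₀-monomial-nonmultiple j d j∤d = ∑-zero d (λ i _ →
      trans (*-congˡ (F-monomial-off i j d (λ eq → j∤d (divides (suc i) (≡.trans eq (ℕₚ.*-comm j (suc i))))))) (zeroʳ _))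

    module _ {N : ℕ} (χ-periodic : ∀ n → 1 ≤ n → χ (n ℕ.+ N) ≈ χ n) where

      χ-periodic-multiple : ∀ t n → 1 ≤ n → χ (n ℕ.+ t ℕ.* N) ≈ χ n
      χ-periodic-multiple zero    n _   = reflexive (≡.cong χ (ℕₚ.+-identityʳ n))
      χ-periodic-multiple (suc t) n 1≤n = begin
        χ (n ℕ.+ (N ℕ.+ t ℕ.* N))  ≡⟨ ≡.cong χ (≡.trans (≡.cong (n ℕ.+_) (ℕₚ.+-comm N (t ℕ.* N))) (≡.sym (ℕₚ.+-assoc n (t ℕ.* N) N))) ⟩
        χ (n ℕ.+ t ℕ.* N ℕ.+ N)    ≈⟨ χ-periodic (n ℕ.+ t ℕ.* N) (ℕₚ.≤-trans 1≤n (ℕₚ.m≤m+n n _)) ⟩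
        χ (n ℕ.+ t ℕ.* N)          ≈⟨ χ-periodic-multiple t n 1≤n ⟩
        χ n                        ∎

      L₀-monomial-periodic : ∀ j t e → 1 ≤ e →
        L₀ (monomial (suc j)) (t ℕ.* suc j ℕ.* N ℕ.+ e) ≈ L₀ (monomial (suc j)) e
      L₀-monomial-periodic j t e 1≤e with suc j ∣? e
      ... | no j∤e = trans (L₀-monomial-nonmultiple (suc j) _ (λ j∣tjN+e → j∤e (∣m+n∣m⇒∣n j∣tjN+e (n∣m*n*o t N))))
                           (sym (L₀-monomial-nonmultiple (suc j) e j∤e))
      ... | yes (divides zero    ≡.refl) with () ← 1≤e
      ... | yes (divides (suc c) ≡.refl) = begin
        h (t ℕ.* suc j ℕ.* N ℕ.+ suc c ℕ.* suc j)  ≡⟨ ≡.cong h (arith t j N c) ⟩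
        h (suc j ℕ.* suc (c ℕ.+ t ℕ.* N))          ≈⟨ L₀-monomial-multiple j (c ℕ.+ t ℕ.* N) ⟩
        χ (suc c ℕ.+ t ℕ.* N)                      ≈⟨ χ-periodic-multiple t (suc c) (s≤s z≤n) ⟩
        χ (suc c)                                  ≈⟨ L₀-monomial-multiple j c ⟨
        h (suc j ℕ.* suc c)                        ≡⟨ ≡.cong h (ℕₚ.*-comm (suc j) (suc c)) ⟩
        h (suc c ℕ.* suc j)                        ∎
        where
        h : Ser
        h = L₀ (monomial (suc j))
        arith : ∀ t j N c → t ℕ.* suc j ℕ.* N ℕ.+ suc c ℕ.* suc j ≡ suc j ℕ.* suc (c ℕ.+ t ℕ.* N)
        arith = solve-∀

      L₀-periodic : ∀ J Q → Q 0 ≈ 0# → VanishesFrom J Q → ∀ e → 1 ≤ e → L₀ Q (J ! ℕ.* N ℕ.+ e) ≈ L₀ Q e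
      L₀-periodic J Q Q0≈0 Q≈0 e 1≤e = begin
        L₀ Q (J ! ℕ.* N ℕ.+ e)                                 ≈⟨ L₀-expansion (J ! ℕ.* N ℕ.+ e) ⟩
        ∑ J (λ j → Q j * L₀ (monomial j) (J ! ℕ.* N ℕ.+ e))    ≈⟨ ∑-cong-< J summand-periodic ⟩
        ∑ J (λ j → Q j * L₀ (monomial j) e)                    ≈⟨ L₀-expansion e ⟨
        L₀ Q e                                                 ∎
        where
        L₀-expansion : ∀ d → L₀ Q d ≈ ∑ J (λ j → Q j * L₀ (monomial j) d)
        L₀-expansion d = trans (L₀-cong (monomial-expansion J Q Q≈0) d)
                               (trans (L₀-∑ₛ J _ d) (∑-cong J (λ j → L₀-scale (Q j) (monomial j) d)))
        summand-periodic : ∀ j → j < J → Q j * L₀ (monomial j) (J ! ℕ.* N ℕ.+ e) ≈ Q j * L₀ (monomial j) e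
        summand-periodic zero    _   = trans (*-congʳ Q0≈0) (trans (zeroˡ _) (sym (trans (*-congʳ Q0≈0) (zeroˡ _))))
        summand-periodic (suc j) j<J with divides t J!≡t*[1+j] ← ∣-trans (m∣m*n (j !)) (m≤n⇒m!∣n! (ℕₚ.<⇒≤ j<J)) =
          *-congˡ (trans (reflexive (≡.cong (λ x → L₀ (monomial (suc j)) (x ℕ.* N ℕ.+ e)) J!≡t*[1+j]))
                         (L₀-monomial-periodic j t e 1≤e))

  truncate : ℕ → Ser → Poly R
  truncate zero    f = []
  truncate (suc K) f = f 0 ∷ truncate K (f ∘ suc)

  coeff-truncate : ∀ K f → VanishesFrom K f → coeff R (truncate K f) ≋ f
  coeff-truncate zero    f f≈0 d       = sym (f≈0 d z≤n)
  coeff-truncate (suc K) f f≈0 zero    = refl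
  coeff-truncate (suc K) f f≈0 (suc d) = coeff-truncate K (f ∘ suc) (λ e K≤e → f≈0 (suc e) (s≤s K≤e)) d

  coeff-vanishes : ∀ A → VanishesFrom (length A) (coeff R A)
  coeff-vanishes []      e       _         = refl
  coeff-vanishes (a ∷ A) (suc e) (s≤s A≤e) = coeff-vanishes A e A≤e

  rational-if-polynomial-multiple : ∀ {K K′} b f → b 0 ≈ 1# → VanishesFrom K b → VanishesFrom K′ (b ⋆ f) →
                                    IsRationalExpansion R f
  rational-if-polynomial-multiple {K} {K′} b f b0≈1 b≈0 b⋆f≈0 =
    truncate K′ (b ⋆ f) , truncate K b , trans (coeff-truncate K b b≈0 0) b0≈1 ,
    λ d → trans (⋆-congˡ f (coeff-truncate K b b≈0) d) (sym (coeff-truncate K′ (b ⋆ f) b⋆f≈0 d))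

  Lq-rational : ∀ χ N → 1 ≤ N → (∀ n → 1 ≤ n → χ (n ℕ.+ N) ≈ χ n) →
                ∀ P → coeff R P 0 ≈ 0# → ∀ k → IsRationalExpansion R (Lq R χ k (coeff R P))
  Lq-rational χ N 1≤N χ-periodic P P0≈0 k =
    rational-if-polynomial-multiple b L b0≈1 (Δ-vanishes M _ (Δ^-vanishes 1 k 1 one-vanishes))
      (VanishesFrom-resp (≋-sym b⋆L≋Δ[L₀Q]) (Δ-periodic-vanishes M (L₀ χ Q) (L₀-periodic χ χ-periodic J Q Q0≈0 Q-vanishes)))
    where
    L Q : Ser
    L = Lq R χ k (coeff R P)
    Q = Δ^ 1 k (coeff R P)
    J M : ℕ
    J = k ℕ.* 1 ℕ.+ length P
    M = J ! ℕ.* N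
    b : Ser
    b = Δ M (Δ^ 1 k one)
    one-vanishes : VanishesFrom 1 one
    one-vanishes (suc e) _ = refl
    b0≈1 : b 0 ≈ 1#
    b0≈1 = trans (Δ-at-zero M _ (ℕₚ.*-mono-≤ (ℕₚ.1≤n! J) 1≤N)) (Δ^-at-zero 1 k one (s≤s z≤n))
    Q0≈0 : Q 0 ≈ 0#
    Q0≈0 = trans (Δ^-at-zero 1 k (coeff R P) (s≤s z≤n)) P0≈0
    Q-vanishes : VanishesFrom J Q
    Q-vanishes = Δ^-vanishes 1 k (length P) (coeff-vanishes P)
    b⋆L≋Δ[L₀Q] : b ⋆ L ≋ Δ M (L₀ χ Q)
    b⋆L≋Δ[L₀Q] d = begin
      (Δ M (Δ^ 1 k one) ⋆ L) d  ≈⟨ Δ-⋆ M _ L d ⟨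
      Δ M (Δ^ 1 k one ⋆ L) d    ≈⟨ Δ-cong M (λ e → trans (sym (Δ^-⋆ 1 k one L e)) (Δ^-cong 1 k (⋆-identityˡ L) e)) d ⟩
      Δ M (Δ^ 1 k L) d          ≈⟨ Δ-cong M (Δ^-Lq χ k (coeff R P) P0≈0) d ⟩
      Δ M (L₀ χ Q) d            ∎

open import Data.Integer using (ℤ; ∣_∣; _≤_; 0ℤ)

mainTheorem7 : {c ℓ : Level} (R : CommutativeRing c ℓ)
    → (χ : ℕ → CommutativeRing.Carrier R) → IsDirichletCharacter R χ
    → (P : Poly R) → CommutativeRing._≈_ R (coeff R P 0) (CommutativeRing.0# R)
    → (i : ℤ) → i ≤ 0ℤ
    → IsRationalExpansion R (Lq R χ ∣ i ∣ (coeff R P))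
mainTheorem7 R χ isχ P P0≈0 i _ = Rationality.Lq-rational R χ period period-pos periodic P P0≈0 ∣ i ∣
  where open IsDirichletCharacter isχ
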